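{- Let $H:\mathbb N\to\mathbb N$ be defined by $H(0)=0$ and $H(i)=i-H(H(H(i-1)))$ for $i\ge1$, and let $\alpha\approx1.46557123$ be the unique real root of $X^3-X^2-1$. Then for all $i\ge 0$, $H(i)-\lfloor \alpha^{ -1} i\rfloor\in\{0,1\}$. -}

module Defs where

open import Data.Nat using (ℕ; suc; _+_; _*_; _≤_)
open import Data.Product using (_×_)
open import Relation.Nullary using (¬_)

-- For natural numbers m, i we express  m·α ≤ i  without real numbers:
-- with f(x) = x³ - x² - 1, f(x) < 0 for all x < α and f(x) > 0 for x > α,
-- so for m > 0:  m·α ≤ i  ⇔  α ≤ i/m  ⇔  f(i/m) ≥ 0  ⇔  i²·m + m³ ≤ i³.
-- For m = 0 both sides hold (0 ≤ i³).
_·α≤_ : ℕ → ℕ → Set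
m ·α≤ i = i * i * m + m * m * m ≤ i * i * i

IsFloorDivα : ℕ → ℕ → Set
IsFloorDivα i m = (m ·α≤ i) × ¬ (suc m ·α≤ i)

{-# OPTIONS --safe #-}
module Submission where

open import Defs
open import Function using (_∘_)
open import Data.Nat as ℕ using (ℕ; zero; suc; _+_; _*_; _∸_; _≤_; _<_; s≤s; z≤n)
import Data.Nat.Properties as ℕ
open import Data.Nat.Induction using (<-rec)
open import Data.Nat.Tactic.RingSolver using () renaming (solve to ℕ-solve)
open import Data.Integer as ℤ using (ℤ; +_; -[1+_]; 0ℤ; 1ℤ; -1ℤ)
import Data.Integer.Properties as ℤ
open import Data.Integer.Tactic.RingSolver using () renaming (ring to ℤ-ring)
open import Data.Fin using (Fin; #_)
open import Data.Vec as Vec using (Vec; _++_)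
open import Data.Vec.Relation.Unary.All.Properties using (lookup⁺)
open import Data.List using ([]; _∷_)
open import Data.Product using (Σ; ∃-syntax; _×_; _,_; proj₁)
open import Data.Sum using (_⊎_; inj₁; inj₂; [_,_]′)
open import Data.Maybe using (Maybe; just; nothing)
open import Level using (0ℓ)
open import Relation.Nullary using (¬_; Dec; yes; no)
open import Relation.Nullary.Decidable using (True; toWitness; _×-dec_)
open import Relation.Binary.PropositionalEquality
open import Algebra.Structures using (IsCommutativeRing)
open import Tactic.RingSolver using () renaming (solve-∀ to ring-solve-∀)
open import Tactic.RingSolver.Core.AlmostCommutativeRing using (AlmostCommutativeRing; fromCommutativeRing)
import Tactic.RingSolver.NonReflective ℤ-ring as ℤ-Solver

-- Let N be Narayana's sequence, N(k + 3) = N(k + 2) + N(k). In the greedy expansion of n as a sum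
-- of Narayana numbers, H lowers every index by one. Hence the discrepancy vector
-- w n = (H n·α − n , H (H n)·α − H n) ∈ ℤ[α]² is a sum of vectors M^k E₀, where M realises the
-- Narayana recurrence on ℤ[α]² and is a contraction (its eigenvalues are the complex roots of
-- X³ − X² − 1). An explicit polygon Q with M Q ⊆ Q, 20 E₀ + M³ Q ⊆ Q and 0 ∈ Q has its first
-- coordinates in the strip 2 − 20α ≤ X ≤ 20α, so 20 (H n·α − n) lies in that strip, i.e.
-- (H n − 1)α ≤ n < (H n + 1)α, and this pins H n to ⌊n/α⌋ or ⌊n/α⌋ + 1.
-- Real inequalities are certified inside ℤ[α] (t ≥ 0 when α^k t has natural coefficients) and
-- then read off as cubic inequalities between natural numbers.

-- ⟨ a , b , c ⟩ stands for a + bα + cα², where α is the real root of X³ − X² − 1.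
record Coeffs (A : Set) : Set where
  constructor ⟨_,_,_⟩
  field
    c₀ c₁ c₂ : A
open Coeffs

map³ : {A B : Set} → (A → B) → Coeffs A → Coeffs B
map³ f ⟨ a₀ , a₁ , a₂ ⟩ = ⟨ f a₀ , f a₁ , f a₂ ⟩

zipWith³ : {A B C : Set} → (A → B → C) → Coeffs A → Coeffs B → Coeffs C
zipWith³ f ⟨ a₀ , a₁ , a₂ ⟩ ⟨ b₀ , b₁ , b₂ ⟩ = ⟨ f a₀ b₀ , f a₁ b₁ , f a₂ b₂ ⟩

-- Multiply out and reduce with α³ = 1 + α² and α⁴ = 1 + α + α².
mulα : {A : Set} → (A → A → A) → (A → A → A) → Coeffs A → Coeffs A → Coeffs A
mulα {A} _+_ _*_ ⟨ a₀ , a₁ , a₂ ⟩ ⟨ b₀ , b₁ , b₂ ⟩ =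
  ⟨ (a₀ * b₀) + (e₃ + e₄) , ((a₀ * b₁) + (a₁ * b₀)) + e₄ , e₂ + (e₃ + e₄) ⟩
  where
  e₂ e₃ e₄ : A
  e₂ = ((a₀ * b₂) + (a₁ * b₁)) + (a₂ * b₀)
  e₃ = (a₁ * b₂) + (a₂ * b₁)
  e₄ = a₂ * b₂

ℤ[α] : Set
ℤ[α] = Coeffs ℤ

infixl 6 _⊕_
infixl 7 _⊗_
infix 8 ⊖_

_⊕_ _⊗_ : ℤ[α] → ℤ[α] → ℤ[α]
_⊕_ = zipWith³ ℤ._+_
_⊗_ = mulα ℤ._+_ ℤ._*_

⊖_ : ℤ[α] → ℤ[α]
⊖_ = map³ (ℤ.-_)

𝟘 𝟙 α : ℤ[α]
𝟘 = ⟨ 0ℤ , 0ℤ , 0ℤ ⟩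
𝟙 = ⟨ 1ℤ , 0ℤ , 0ℤ ⟩
α = ⟨ 0ℤ , 1ℤ , 0ℤ ⟩

ι : ℕ → ℤ[α]
ι n = ⟨ + n , 0ℤ , 0ℤ ⟩

-- The three coefficients of an identity between ring expressions in x, y, z are
-- polynomials in the nine coefficients of x, y, z; the ring solver for ℤ checks them.
-- This is why the operations above are written over an arbitrary signature.
module ByCoefficients where
  open ℤ-Solver using (Expr; Κ; Ι; ⊝_) renaming (_⊕_ to _+ᵉ_; _⊗_ to _*ᵉ_)
  open ℤ-Solver.Ops using (⟦_⟧; ⟦_⇓⟧; correct)

  Expr³ : Set
  Expr³ = Coeffs (Expr ℤ 9)

  infixl 6 _⊕ᵉ_
  infixl 7 _⊗ᵉ_

  _⊕ᵉ_ _⊗ᵉ_ : Expr³ → Expr³ → Expr³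
  _⊕ᵉ_ = zipWith³ _+ᵉ_
  _⊗ᵉ_ = mulα _+ᵉ_ _*ᵉ_

  ⊖ᵉ_ : Expr³ → Expr³
  ⊖ᵉ_ = map³ ⊝_

  κ³ : ℤ[α] → Expr³
  κ³ = map³ Κ

  X Y Z : Expr³
  X = ⟨ Ι (# 0) , Ι (# 1) , Ι (# 2) ⟩
  Y = ⟨ Ι (# 3) , Ι (# 4) , Ι (# 5) ⟩
  Z = ⟨ Ι (# 6) , Ι (# 7) , Ι (# 8) ⟩

  env : ℤ[α] → ℤ[α] → ℤ[α] → Vec ℤ 9
  env x y z = coeffs x ++ coeffs y ++ coeffs z
    where
    coeffs : ℤ[α] → Vec ℤ 3
    coeffs t = c₀ t Vec.∷ c₁ t Vec.∷ c₂ t Vec.∷ Vec.[]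

  ⟦_⟧³ ⟦_⇓⟧³ : Expr³ → Vec ℤ 9 → ℤ[α]
  ⟦ P ⟧³ ρ = map³ (λ p → ⟦ p ⟧ ρ) P
  ⟦ P ⇓⟧³ ρ = map³ (λ p → ⟦ p ⇓⟧ ρ) P

  prove : ∀ (P Q : Expr³) x y z → ⟦ P ⇓⟧³ (env x y z) ≡ ⟦ Q ⇓⟧³ (env x y z) →
          ⟦ P ⟧³ (env x y z) ≡ ⟦ Q ⟧³ (env x y z)
  prove P Q x y z eq = trans (sym (correct³ P)) (trans eq (correct³ Q))
    where
    correct³ : ∀ R → ⟦ R ⇓⟧³ (env x y z) ≡ ⟦ R ⟧³ (env x y z)
    correct³ ⟨ r₀ , r₁ , r₂ ⟩ = cong₃ (correct r₀ _) (correct r₁ _) (correct r₂ _)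
      where
      cong₃ : ∀ {a₀ a₁ a₂ b₀ b₁ b₂ : ℤ} → a₀ ≡ b₀ → a₁ ≡ b₁ → a₂ ≡ b₂ →
              ⟨ a₀ , a₁ , a₂ ⟩ ≡ ⟨ b₀ , b₁ , b₂ ⟩
      cong₃ refl refl refl = refl

open ByCoefficients using (prove; κ³; X; Y; Z; _⊕ᵉ_; _⊗ᵉ_; ⊖ᵉ_)
open ℤ-Solver using (Κ; Ι) renaming (_⊕_ to _+ᵉ_; _⊗_ to _*ᵉ_; ⊝_ to -ᵉ_)

⊕-assoc : ∀ x y z → (x ⊕ y) ⊕ z ≡ x ⊕ (y ⊕ z)
⊕-assoc x y z = prove ((X ⊕ᵉ Y) ⊕ᵉ Z) (X ⊕ᵉ (Y ⊕ᵉ Z)) x y z refl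

⊕-comm : ∀ x y → x ⊕ y ≡ y ⊕ x
⊕-comm x y = prove (X ⊕ᵉ Y) (Y ⊕ᵉ X) x y 𝟘 refl

⊗-assoc : ∀ x y z → (x ⊗ y) ⊗ z ≡ x ⊗ (y ⊗ z)
⊗-assoc x y z = prove ((X ⊗ᵉ Y) ⊗ᵉ Z) (X ⊗ᵉ (Y ⊗ᵉ Z)) x y z refl

⊗-comm : ∀ x y → x ⊗ y ≡ y ⊗ x
⊗-comm x y = prove (X ⊗ᵉ Y) (Y ⊗ᵉ X) x y 𝟘 refl

⊗-distribʳ-⊕ : ∀ x y z → (y ⊕ z) ⊗ x ≡ y ⊗ x ⊕ z ⊗ x
⊗-distribʳ-⊕ x y z = prove ((Y ⊕ᵉ Z) ⊗ᵉ X) (Y ⊗ᵉ X ⊕ᵉ Z ⊗ᵉ X) x y z refl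

⊕-identityˡ : ∀ x → 𝟘 ⊕ x ≡ x
⊕-identityˡ x = prove (κ³ 𝟘 ⊕ᵉ X) X x 𝟘 𝟘 refl

⊕-inverseˡ : ∀ x → ⊖ x ⊕ x ≡ 𝟘
⊕-inverseˡ x = prove (⊖ᵉ X ⊕ᵉ X) (κ³ 𝟘) x 𝟘 𝟘 refl

⊗-identityˡ : ∀ x → 𝟙 ⊗ x ≡ x
⊗-identityˡ x = prove (κ³ 𝟙 ⊗ᵉ X) X x 𝟘 𝟘 refl

ℤ[α]-isCommutativeRing : IsCommutativeRing _≡_ _⊕_ _⊗_ ⊖_ 𝟘 𝟙
ℤ[α]-isCommutativeRing = record
  { isRing = record
    { +-isAbelianGroup = record
      { isGroup = record
        { isMonoid = record
          { isSemigroup = record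
            { isMagma = record { isEquivalence = isEquivalence ; ∙-cong = cong₂ _⊕_ }
            ; assoc = ⊕-assoc
            }
          ; identity = ⊕-identityˡ , λ x → trans (⊕-comm x 𝟘) (⊕-identityˡ x)
          }
        ; inverse = ⊕-inverseˡ , λ x → trans (⊕-comm x (⊖ x)) (⊕-inverseˡ x)
        ; ⁻¹-cong = cong ⊖_
        }
      ; comm = ⊕-comm
      }
    ; *-cong = cong₂ _⊗_
    ; *-assoc = ⊗-assoc
    ; *-identity = ⊗-identityˡ , λ x → trans (⊗-comm x 𝟙) (⊗-identityˡ x)
    ; distrib = (λ x y z → trans (⊗-comm x (y ⊕ z))
                             (trans (⊗-distribʳ-⊕ x y z) (cong₂ _⊕_ (⊗-comm y x) (⊗-comm z x))))
              , ⊗-distribʳ-⊕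
    }
  ; *-comm = ⊗-comm
  }

ℤ[α]-ring : AlmostCommutativeRing 0ℓ 0ℓ
ℤ[α]-ring = fromCommutativeRing (record { isCommutativeRing = ℤ[α]-isCommutativeRing }) 𝟘≟_
  where
  𝟘≟_ : ∀ x → Maybe (𝟘 ≡ x)
  𝟘≟ ⟨ + 0 , + 0 , + 0 ⟩ = just refl
  𝟘≟ _ = nothing

All³ : {A : Set} → (A → Set) → Coeffs A → Set
All³ P t = P (c₀ t) × P (c₁ t) × P (c₂ t)

zipWith³-closed : {A : Set} {_∙_ : A → A → A} (P : A → Set) → (∀ {a b} → P a → P b → P (a ∙ b)) →
                  ∀ {u v} → All³ P u → All³ P v → All³ P (zipWith³ _∙_ u v)
zipWith³-closed P ∙-closed (a₀ , a₁ , a₂) (b₀ , b₁ , b₂) =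
  ∙-closed a₀ b₀ , ∙-closed a₁ b₁ , ∙-closed a₂ b₂

mulα-closed : {A : Set} {_+_ _*_ : A → A → A} (P : A → Set) →
              (∀ {a b} → P a → P b → P (a + b)) → (∀ {a b} → P a → P b → P (a * b)) →
              ∀ {u v} → All³ P u → All³ P v → All³ P (mulα _+_ _*_ u v)
mulα-closed {_+_ = _+_} {_*_} P _⊹_ _⊛_ {u} {v} (a₀ , a₁ , a₂) (b₀ , b₁ , b₂) =
  (a₀ ⊛ b₀) ⊹ (e₃ ⊹ e₄) , ((a₀ ⊛ b₁) ⊹ (a₁ ⊛ b₀)) ⊹ e₄ , (((a₀ ⊛ b₂) ⊹ (a₁ ⊛ b₁)) ⊹ (a₂ ⊛ b₀)) ⊹ (e₃ ⊹ e₄)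
  where
  e₃ : P ((c₁ u * c₂ v) + (c₂ u * c₁ v))
  e₃ = (a₁ ⊛ b₂) ⊹ (a₂ ⊛ b₁)
  e₄ : P (c₂ u * c₂ v)
  e₄ = a₂ ⊛ b₂

data IsNat : ℤ → Set where
  nat : ∀ n → IsNat (+ n)

isNat? : ∀ i → Dec (IsNat i)
isNat? (+ n) = yes (nat n)
isNat? -[1+ n ] = no λ ()

IsNat-+ : ∀ {i j} → IsNat i → IsNat j → IsNat (i ℤ.+ j)
IsNat-+ (nat m) (nat n) = nat (m + n)

IsNat-* : ∀ {i j} → IsNat i → IsNat j → IsNat (i ℤ.* j)
IsNat-* (nat m) (nat n) = subst IsNat (ℤ.pos-* m n) (nat (m * n))

NatCoeffs : ℤ[α] → Set
NatCoeffs = All³ IsNat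

natCoeffs? : ∀ t → Dec (NatCoeffs t)
natCoeffs? t = isNat? (c₀ t) ×-dec isNat? (c₁ t) ×-dec isNat? (c₂ t)

NatCoeffs-⊕ : ∀ {s t} → NatCoeffs s → NatCoeffs t → NatCoeffs (s ⊕ t)
NatCoeffs-⊕ = zipWith³-closed IsNat IsNat-+

NatCoeffs-⊗ : ∀ {s t} → NatCoeffs s → NatCoeffs t → NatCoeffs (s ⊗ t)
NatCoeffs-⊗ = mulα-closed IsNat IsNat-+ IsNat-*

α^_ : ℕ → ℤ[α]
α^ zero = 𝟙
α^ suc k = α ⊗ α^ k

α^-+ : ∀ j k → α^ (j + k) ≡ α^ j ⊗ α^ k
α^-+ zero k = sym (⊗-identityˡ (α^ k))
α^-+ (suc j) k = trans (cong (α ⊗_) (α^-+ j k)) (sym (⊗-assoc α (α^ j) (α^ k)))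

NatCoeffs-α^ : ∀ k → NatCoeffs (α^ k)
NatCoeffs-α^ zero = nat 1 , nat 0 , nat 0
NatCoeffs-α^ (suc k) = NatCoeffs-⊗ (nat 0 , nat 1 , nat 0) (NatCoeffs-α^ k)

-- Since α > 0, Nonneg t implies t ≥ 0 under the real embedding of ℤ[α].
Nonneg : ℤ[α] → Set
Nonneg t = ∃[ k ] NatCoeffs (α^ k ⊗ t)

Nonneg-⊕ : ∀ {s t} → Nonneg s → Nonneg t → Nonneg (s ⊕ t)
Nonneg-⊕ {s} {t} (j , ns) (k , nt) =
  j + k ,
  subst NatCoeffs eq (NatCoeffs-⊕ (NatCoeffs-⊗ (NatCoeffs-α^ k) ns) (NatCoeffs-⊗ (NatCoeffs-α^ j) nt))
  where
  rearrange : ∀ a b x y → b ⊗ (a ⊗ x) ⊕ a ⊗ (b ⊗ y) ≡ (a ⊗ b) ⊗ (x ⊕ y)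
  rearrange = ring-solve-∀ ℤ[α]-ring
  eq : α^ k ⊗ (α^ j ⊗ s) ⊕ α^ j ⊗ (α^ k ⊗ t) ≡ α^ (j + k) ⊗ (s ⊕ t)
  eq = trans (rearrange (α^ j) (α^ k) s t) (cong (_⊗ (s ⊕ t)) (sym (α^-+ j k)))

Nonneg-⊗ : ∀ {s t} → Nonneg s → Nonneg t → Nonneg (s ⊗ t)
Nonneg-⊗ {s} {t} (j , ns) (k , nt) = j + k , subst NatCoeffs eq (NatCoeffs-⊗ ns nt)
  where
  rearrange : ∀ a b x y → (a ⊗ x) ⊗ (b ⊗ y) ≡ (a ⊗ b) ⊗ (x ⊗ y)
  rearrange = ring-solve-∀ ℤ[α]-ring
  eq : (α^ j ⊗ s) ⊗ (α^ k ⊗ t) ≡ α^ (j + k) ⊗ (s ⊗ t)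
  eq = trans (rearrange (α^ j) (α^ k) s t) (cong (_⊗ (s ⊗ t)) (sym (α^-+ j k)))

ι-⊗ : ∀ n t → ι n ⊗ t ≡ map³ (+ n ℤ.*_) t
ι-⊗ n t = prove (⟨ Ι (# 0) , Κ 0ℤ , Κ 0ℤ ⟩ ⊗ᵉ Y) (map³ (Ι (# 0) *ᵉ_) Y) (ι n) t 𝟘 refl

NatCoeffs-cancel : ∀ n {t} → NatCoeffs (ι (suc n) ⊗ t) → NatCoeffs t
NatCoeffs-cancel n {t} nt with subst NatCoeffs (ι-⊗ (suc n) t) nt
... | n₀ , n₁ , n₂ = cancel n₀ , cancel n₁ , cancel n₂
  where
  cancel : ∀ {i} → IsNat (+ suc n ℤ.* i) → IsNat i
  cancel {+ m} _ = nat m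
  cancel { -[1+ _ ] } ()

Nonneg-cancel : ∀ n {t} → Nonneg (ι (suc n) ⊗ t) → Nonneg t
Nonneg-cancel n {t} (k , nt) = k , NatCoeffs-cancel n (subst NatCoeffs (swap (α^ k) (ι (suc n)) t) nt)
  where
  swap : ∀ a b x → a ⊗ (b ⊗ x) ≡ b ⊗ (a ⊗ x)
  swap = ring-solve-∀ ℤ[α]-ring

α⊗ : ∀ t → α ⊗ t ≡ ⟨ c₂ t , c₀ t , c₁ t ℤ.+ c₂ t ⟩
α⊗ t = prove (κ³ α ⊗ᵉ X) ⟨ c₂ X , c₀ X , c₁ X +ᵉ c₂ X ⟩ t 𝟘 𝟘 refl

α^[2+k]-coeffs : ∀ k → ∃[ p ] ∃[ q ] ∃[ r ] α^ (2 + k) ≡ ⟨ + p , + q , + suc r ⟩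
α^[2+k]-coeffs zero = 0 , 0 , 0 , refl
α^[2+k]-coeffs (suc k) with α^[2+k]-coeffs k
... | p , q , r , eq = suc r , p , q + r , (begin
  α ⊗ α^ (2 + k)                    ≡⟨ cong (α ⊗_) eq ⟩
  α ⊗ ⟨ + p , + q , + suc r ⟩       ≡⟨ α⊗ ⟨ + p , + q , + suc r ⟩ ⟩
  ⟨ + suc r , + p , + (q + suc r) ⟩ ≡⟨ cong (λ n → ⟨ + suc r , + p , + n ⟩) (ℕ.+-suc q r) ⟩
  ⟨ + suc r , + p , + suc (q + r) ⟩ ∎)
  where open ≡-Reasoning

Nonneg⇒multiplier : ∀ {t} → Nonneg t → ∃[ p ] ∃[ q ] ∃[ r ] NatCoeffs (⟨ + p , + q , + suc r ⟩ ⊗ t)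
Nonneg⇒multiplier {t} (k , nt) with α^[2+k]-coeffs k
... | p , q , r , eq = p , q , r , subst NatCoeffs eq′ (NatCoeffs-⊗ (NatCoeffs-α^ 2) nt)
  where
  eq′ : α^ 2 ⊗ (α^ k ⊗ t) ≡ ⟨ + p , + q , + suc r ⟩ ⊗ t
  eq′ = trans (sym (⊗-assoc (α^ 2) (α^ k) t)) (cong (_⊗ t) (trans (sym (α^-+ 2 k)) eq))

IsNat-∸⇒≤ : ∀ {a b c d} → IsNat (+ a ℤ.* + b ℤ.- + c ℤ.* + d) → c * d ≤ a * b
IsNat-∸⇒≤ {a} {b} {c} {d} n =
  ℤ.drop‿+≤+ (subst₂ ℤ._≤_ (sym (ℤ.pos-* c d)) (sym (ℤ.pos-* a b)) (ℤ.0≤i-j⇒j≤i (0≤ n)))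
  where
  0≤ : ∀ {i} → IsNat i → 0ℤ ℤ.≤ i
  0≤ (nat _) = ℤ.+≤+ z≤n

⊗-[y-xα] : ∀ p q r y x → ⟨ p , q , r ⟩ ⊗ ⟨ y , ℤ.- x , 0ℤ ⟩ ≡
  ⟨ p ℤ.* y ℤ.- r ℤ.* x , q ℤ.* y ℤ.- p ℤ.* x , r ℤ.* y ℤ.- (q ℤ.+ r) ℤ.* x ⟩
⊗-[y-xα] p q r y x = prove (X ⊗ᵉ ⟨ c₀ Y , -ᵉ c₁ Y , Κ 0ℤ ⟩)
  ⟨ c₀ X *ᵉ c₀ Y +ᵉ -ᵉ (c₂ X *ᵉ c₁ Y)
  , c₁ X *ᵉ c₀ Y +ᵉ -ᵉ (c₀ X *ᵉ c₁ Y)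
  , c₂ X *ᵉ c₀ Y +ᵉ -ᵉ ((c₁ X +ᵉ c₂ X) *ᵉ c₁ Y) ⟩
  ⟨ p , q , r ⟩ ⟨ y , x , 0ℤ ⟩ 𝟘 refl

⊗-[xα-y] : ∀ p q r y x → ⟨ p , q , r ⟩ ⊗ ⟨ ℤ.- y , x , 0ℤ ⟩ ≡
  ⟨ r ℤ.* x ℤ.- p ℤ.* y , p ℤ.* x ℤ.- q ℤ.* y , (q ℤ.+ r) ℤ.* x ℤ.- r ℤ.* y ⟩
⊗-[xα-y] p q r y x = prove (X ⊗ᵉ ⟨ -ᵉ c₀ Y , c₁ Y , Κ 0ℤ ⟩)
  ⟨ c₂ X *ᵉ c₁ Y +ᵉ -ᵉ (c₀ X *ᵉ c₀ Y)
  , c₀ X *ᵉ c₁ Y +ᵉ -ᵉ (c₁ X *ᵉ c₀ Y)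
  , (c₁ X +ᵉ c₂ X) *ᵉ c₁ Y +ᵉ -ᵉ (c₂ X *ᵉ c₀ Y) ⟩
  ⟨ p , q , r ⟩ ⟨ y , x , 0ℤ ⟩ 𝟘 refl

-- y ≤·α x encodes y ≤ xα, as x ·α≤ y encodes xα ≤ y.
_≤·α_ : ℕ → ℕ → Set
y ≤·α x = y * y * y ≤ y * y * x + x * x * x

·α≤-from-multiplier : ∀ {p q R x y} .{{_ : ℕ.NonZero R}} →
                      R * x ≤ p * y → p * x ≤ q * y → (q + R) * x ≤ R * y → x ·α≤ y
·α≤-from-multiplier {p} {q} {R} {x} {y} Rx≤py px≤qy [q+R]x≤Ry = ℕ.*-cancelˡ-≤ R (begin
  R * (y * y * x + x * x * x)        ≡⟨ ℕ-solve (R ∷ x ∷ y ∷ []) ⟩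
  y * y * (R * x) + x * x * (R * x)  ≤⟨ ℕ.+-monoʳ-≤ (y * y * (R * x)) (ℕ.*-monoʳ-≤ (x * x) Rx≤py) ⟩
  y * y * (R * x) + x * x * (p * y)  ≡⟨ ℕ-solve (R ∷ p ∷ x ∷ y ∷ []) ⟩
  y * y * (R * x) + x * y * (p * x)  ≤⟨ ℕ.+-monoʳ-≤ (y * y * (R * x)) (ℕ.*-monoʳ-≤ (x * y) px≤qy) ⟩
  y * y * (R * x) + x * y * (q * y)  ≡⟨ ℕ-solve (R ∷ q ∷ x ∷ y ∷ []) ⟩
  y * y * ((q + R) * x)              ≤⟨ ℕ.*-monoʳ-≤ (y * y) [q+R]x≤Ry ⟩
  y * y * (R * y)                    ≡⟨ ℕ-solve (R ∷ y ∷ []) ⟩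
  R * (y * y * y)                    ∎)
  where open ℕ.≤-Reasoning

≤·α-from-multiplier : ∀ {p q R x y} .{{_ : ℕ.NonZero R}} →
                      p * y ≤ R * x → q * y ≤ p * x → R * y ≤ (q + R) * x → y ≤·α x
≤·α-from-multiplier {p} {q} {R} {x} {y} py≤Rx qy≤px Ry≤[q+R]x = ℕ.*-cancelˡ-≤ R (begin
  R * (y * y * y)                    ≡⟨ ℕ-solve (R ∷ y ∷ []) ⟩
  y * y * (R * y)                    ≤⟨ ℕ.*-monoʳ-≤ (y * y) Ry≤[q+R]x ⟩
  y * y * ((q + R) * x)              ≡⟨ ℕ-solve (R ∷ q ∷ x ∷ y ∷ []) ⟩
  x * y * (q * y) + R * (y * y * x)  ≤⟨ ℕ.+-monoˡ-≤ (R * (y * y * x)) (ℕ.*-monoʳ-≤ (x * y) qy≤px) ⟩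
  x * y * (p * x) + R * (y * y * x)  ≡⟨ ℕ-solve (R ∷ p ∷ x ∷ y ∷ []) ⟩
  x * x * (p * y) + R * (y * y * x)  ≤⟨ ℕ.+-monoˡ-≤ (R * (y * y * x)) (ℕ.*-monoʳ-≤ (x * x) py≤Rx) ⟩
  x * x * (R * x) + R * (y * y * x)  ≡⟨ ℕ-solve (R ∷ x ∷ y ∷ []) ⟩
  R * (y * y * x + x * x * x)        ∎)
  where open ℕ.≤-Reasoning

Nonneg⇒·α≤ : ∀ {x y} → Nonneg ⟨ + y , ℤ.- + x , 0ℤ ⟩ → x ·α≤ y
Nonneg⇒·α≤ {x} {y} nn =
  let p , q , r , nc = Nonneg⇒multiplier nn
      n₀ , n₁ , n₂ = subst NatCoeffs (⊗-[y-xα] (+ p) (+ q) (+ suc r) (+ y) (+ x)) nc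
  in  ·α≤-from-multiplier {p} {q} {suc r} (IsNat-∸⇒≤ {p} {y} {suc r} {x} n₀)
        (IsNat-∸⇒≤ {q} {y} {p} {x} n₁) (IsNat-∸⇒≤ {suc r} {y} {q + suc r} {x} n₂)

Nonneg⇒≤·α : ∀ {x y} → Nonneg ⟨ ℤ.- + y , + x , 0ℤ ⟩ → y ≤·α x
Nonneg⇒≤·α {x} {y} nn =
  let p , q , r , nc = Nonneg⇒multiplier nn
      n₀ , n₁ , n₂ = subst NatCoeffs (⊗-[xα-y] (+ p) (+ q) (+ suc r) (+ y) (+ x)) nc
  in  ≤·α-from-multiplier {p} {q} {suc r} (IsNat-∸⇒≤ {suc r} {x} {p} {y} n₀)
        (IsNat-∸⇒≤ {p} {x} {q} {y} n₁) (IsNat-∸⇒≤ {q + suc r} {x} {suc r} {y} n₂)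

0·α≤ : ∀ i → 0 ·α≤ i
0·α≤ i = subst (_≤ i * i * i) (sym (trans (ℕ.+-identityʳ (i * i * 0)) (ℕ.*-zeroʳ (i * i)))) z≤n

·α≤-antitone : ∀ {m m′ i} → m ≤ m′ → m′ ·α≤ i → m ·α≤ i
·α≤-antitone {i = i} m≤m′ =
  ℕ.≤-trans (ℕ.+-mono-≤ (ℕ.*-monoʳ-≤ (i * i) m≤m′) (ℕ.*-mono-≤ (ℕ.*-mono-≤ m≤m′ m≤m′) m≤m′))

·α≤-scale : ∀ k {m i} → m ·α≤ i → (k * m) ·α≤ (k * i)
·α≤-scale k {m} {i} mα≤i = begin
  k * i * (k * i) * (k * m) + k * m * (k * m) * (k * m)  ≡⟨ ℕ-solve (k ∷ m ∷ i ∷ []) ⟩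
  k * k * k * (i * i * m + m * m * m)                    ≤⟨ ℕ.*-monoʳ-≤ (k * k * k) mα≤i ⟩
  k * k * k * (i * i * i)                                ≡⟨ ℕ-solve (k ∷ i ∷ []) ⟩
  k * i * (k * i) * (k * i)                              ∎
  where open ℕ.≤-Reasoning

·α≤⇒¬suc≤·α : ∀ {m u} → m ·α≤ u → ¬ (suc u ≤·α m)
·α≤⇒¬suc≤·α {m} {u} mα≤u = ℕ.<⇒≱ (begin-strict
  suc u * suc u * m + m * m * m               ≡⟨ ℕ-solve (u ∷ m ∷ []) ⟩
  (u * u * m + m * m * m) + (2 * u + 1) * m   ≤⟨ ℕ.+-mono-≤ mα≤u (ℕ.*-monoʳ-≤ (2 * u + 1) m≤u) ⟩
  u * u * u + (2 * u + 1) * u                 <⟨ ℕ.m<m+n (u * u * u + (2 * u + 1) * u) (s≤s z≤n) ⟩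
  u * u * u + (2 * u + 1) * u + suc (u * u + 2 * u)  ≡⟨ ℕ-solve (u ∷ []) ⟩
  suc u * suc u * suc u                       ∎)
  where
  open ℕ.≤-Reasoning
  m≤u : m ≤ u
  m≤u = ℕ.≮⇒≥ λ u<m →
    ℕ.<⇒≱ (ℕ.*-mono-< (ℕ.*-mono-< u<m u<m) u<m) (ℕ.≤-trans (ℕ.m≤n+m (m * m * m) (u * u * m)) mα≤u)

·α≤-< : ∀ {m n i} → m ·α≤ i → ¬ (n ·α≤ i) → m < n
·α≤-< {i = i} mα≤i ¬nα≤i = ℕ.≰⇒> λ n≤m → ¬nα≤i (·α≤-antitone {i = i} n≤m mα≤i)

floor-pinned : ∀ {h m i} → (h ∸ 1) ·α≤ i → ¬ (suc h ·α≤ i) → IsFloorDivα i m → h ≡ m ⊎ h ≡ suc m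
floor-pinned {h} {m} {i} upper lower (mα≤i , ¬[1+m]α≤i) =
  pinned h (ℕ.≤-pred (·α≤-< {i = i} upper ¬[1+m]α≤i)) (ℕ.≤-pred (·α≤-< {i = i} mα≤i lower))
  where
  pinned : ∀ h → h ∸ 1 ≤ m → m ≤ h → h ≡ m ⊎ h ≡ suc m
  pinned zero _ z≤n = inj₁ refl
  pinned (suc h) h≤m m≤1+h with ℕ.m≤n⇒m<n∨m≡n m≤1+h
  ... | inj₁ m<1+h = inj₂ (cong suc (ℕ.≤-antisym h≤m (ℕ.≤-pred m<1+h)))
  ... | inj₂ m≡1+h = inj₁ (sym m≡1+h)

StepAt : (ℕ → ℕ) → ℕ → Set
StepAt f n = f (suc n) ≡ f n ⊎ f (suc n) ≡ suc (f n)

StepAt-∘ : ∀ {f g n} → StepAt f n → StepAt g (f n) → StepAt (g ∘ f) n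
StepAt-∘ {g = g} (inj₁ e) _ = inj₁ (cong g e)
StepAt-∘ {g = g} (inj₂ e) (inj₁ e′) = inj₁ (trans (cong g e) e′)
StepAt-∘ {g = g} (inj₂ e) (inj₂ e′) = inj₂ (trans (cong g e) e′)

steps⇒≤ : ∀ {f} → f 0 ≡ 0 → ∀ n → (∀ {m} → m < n → StepAt f m) → f n ≤ n
steps⇒≤ f0 zero _ = ℕ.≤-reflexive f0
steps⇒≤ {f} f0 (suc n) steps = last-step (steps (ℕ.n<1+n n))
  where
  fn≤n : f n ≤ n
  fn≤n = steps⇒≤ f0 n (steps ∘ ℕ.m<n⇒m<1+n)
  last-step : StepAt f n → f (suc n) ≤ suc n
  last-step (inj₁ e) = ℕ.≤-trans (ℕ.≤-reflexive e) (ℕ.m≤n⇒m≤1+n fn≤n)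
  last-step (inj₂ e) = ℕ.≤-trans (ℕ.≤-reflexive e) (s≤s fn≤n)

steps⇒mono : ∀ {f} → (∀ n → StepAt f n) → ∀ {m n} → m ≤ n → f m ≤ f n
steps⇒mono {f} steps {m} m≤n = subst (λ k → f m ≤ f k) (ℕ.m+[n∸m]≡n m≤n) (go (_ ∸ m))
  where
  go : ∀ d → f m ≤ f (m + d)
  go zero = ℕ.≤-reflexive (cong f (sym (ℕ.+-identityʳ m)))
  go (suc d) = subst (λ k → f m ≤ f k) (sym (ℕ.+-suc m d)) (step (steps (m + d)))
    where
    step : StepAt f (m + d) → f m ≤ f (suc (m + d))
    step (inj₁ e) = ℕ.≤-trans (go d) (ℕ.≤-reflexive (sym e))
    step (inj₂ e) = ℕ.≤-trans (go d) (ℕ.≤-trans (ℕ.n≤1+n _) (ℕ.≤-reflexive (sym e)))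

nar : ℕ → ℕ
nar 0 = 0
nar 1 = 1
nar 2 = 1
nar (suc (suc (suc k))) = nar (suc (suc k)) + nar k

nar-≤-suc : ∀ k → nar k ≤ nar (suc k)
nar-≤-suc 0 = z≤n
nar-≤-suc 1 = ℕ.≤-refl
nar-≤-suc (suc (suc k)) = ℕ.m≤m+n (nar (suc (suc k))) (nar k)

nar-pos : ∀ k → 1 ≤ nar (suc k)
nar-pos 0 = ℕ.≤-refl
nar-pos 1 = ℕ.≤-refl
nar-pos (suc (suc k)) = ℕ.≤-trans (nar-pos (suc k)) (nar-≤-suc (suc (suc k)))

n<nar[3+n] : ∀ n → n < nar (3 + n)
n<nar[3+n] zero = ℕ.≤-refl
n<nar[3+n] (suc n) =
  ℕ.≤-trans (ℕ.≤-reflexive (ℕ.+-comm 1 (suc n))) (ℕ.+-mono-≤ (n<nar[3+n] n) (nar-pos n))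

nar-split : ∀ k {n} → n < nar (4 + k) → nar (3 + k) ≤ n → n ∸ nar (3 + k) < nar (1 + k)
nar-split k {n} n<nar a≤n =
  ℕ.+-cancelˡ-< (nar (3 + k)) _ _ (subst (_< nar (4 + k)) (sym (ℕ.m+[n∸m]≡n a≤n)) n<nar)

∸-absorbˡ : ∀ a b s x → x ≤ s → suc (a + b + s) ∸ (b + x) ≡ a + (suc s ∸ x)
∸-absorbˡ a b s x x≤s = begin
  suc (a + b + s) ∸ (b + x)  ≡⟨ cong (_∸ (b + x)) (ℕ-solve (a ∷ b ∷ s ∷ [])) ⟩
  b + (a + suc s) ∸ (b + x)  ≡⟨ ℕ.[m+n]∸[m+o]≡n∸o b (a + suc s) x ⟩
  a + suc s ∸ x              ≡⟨ ℕ.+-∸-assoc a (ℕ.m≤n⇒m≤1+n x≤s) ⟩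
  a + (suc s ∸ x)            ∎
  where open ≡-Reasoning

ℤ[α]² : Set
ℤ[α]² = ℤ[α] × ℤ[α]

infixl 6 _⊞_
infixr 7 _•_

_⊞_ : ℤ[α]² → ℤ[α]² → ℤ[α]²
(x , y) ⊞ (x′ , y′) = x ⊕ x′ , y ⊕ y′

_•_ : ℤ[α] → ℤ[α]² → ℤ[α]²
l • (x , y) = l ⊗ x , l ⊗ y

m₁₁ m₁₂ : ℤ[α]
m₁₁ = ⟨ 1ℤ , -1ℤ , 0ℤ ⟩
m₁₂ = ⟨ 0ℤ , 1ℤ , -1ℤ ⟩

M : ℤ[α]² → ℤ[α]²
M (x , y) = m₁₁ ⊗ x ⊕ m₁₂ ⊗ y , x

M^ : ℕ → ℤ[α]² → ℤ[α]²
M^ zero v = v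
M^ (suc k) v = M^ k (M v)

M^-suc : ∀ k v → M^ (suc k) v ≡ M (M^ k v)
M^-suc zero v = refl
M^-suc (suc k) v = M^-suc k (M v)

M-⊞ : ∀ u v → M (u ⊞ v) ≡ M u ⊞ M v
M-⊞ (x , y) (x′ , y′) = cong (_, x ⊕ x′) (distrib m₁₁ m₁₂ x y x′ y′)
  where
  distrib : ∀ a b x y x′ y′ → a ⊗ (x ⊕ x′) ⊕ b ⊗ (y ⊕ y′) ≡ (a ⊗ x ⊕ b ⊗ y) ⊕ (a ⊗ x′ ⊕ b ⊗ y′)
  distrib = ring-solve-∀ ℤ[α]-ring

M-• : ∀ l v → M (l • v) ≡ l • M v
M-• l (x , y) = cong (_, l ⊗ x) (commute m₁₁ m₁₂ l x y)
  where
  commute : ∀ a b l x y → a ⊗ (l ⊗ x) ⊕ b ⊗ (l ⊗ y) ≡ l ⊗ (a ⊗ x ⊕ b ⊗ y)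
  commute = ring-solve-∀ ℤ[α]-ring

M^-⊞ : ∀ k u v → M^ k (u ⊞ v) ≡ M^ k u ⊞ M^ k v
M^-⊞ zero u v = refl
M^-⊞ (suc k) u v = trans (cong (M^ k) (M-⊞ u v)) (M^-⊞ k (M u) (M v))

M^-• : ∀ k l v → M^ k (l • v) ≡ l • M^ k v
M^-• zero l v = refl
M^-• (suc k) l v = trans (cong (M^ k) (M-• l v)) (M^-• k l (M v))

M^-𝟘 : ∀ k → M^ k (𝟘 , 𝟘) ≡ (𝟘 , 𝟘)
M^-𝟘 zero = refl
M^-𝟘 (suc k) = M^-𝟘 k

infix 8 _α−_

_α−_ : ℕ → ℕ → ℤ[α]
y α− x = ⟨ ℤ.- + x , + y , 0ℤ ⟩

α−-+ : ∀ y x y′ x′ → (y + y′) α− (x + x′) ≡ y α− x ⊕ y′ α− x′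
α−-+ y x y′ x′ = cong (λ c → ⟨ c , + (y + y′) , 0ℤ ⟩) (ℤ.neg-distrib-+ (+ x) (+ x′))

-- W only sees how far (x, y, z) is from the expanding direction (α², α, 1) of the
-- Narayana recurrence (x, y, z) ↦ (x + z, x, y), which M realises on the image of W.
W : ℕ → ℕ → ℕ → ℤ[α]²
W x y z = y α− x , z α− y

M-W : ∀ x y z → M (W x y z) ≡ W (x + z) x y
M-W x y z = cong (_, y α− x)
  (prove (κ³ m₁₁ ⊗ᵉ ⟨ -ᵉ c₀ X , c₁ X , Κ 0ℤ ⟩ ⊕ᵉ κ³ m₁₂ ⊗ᵉ ⟨ -ᵉ c₁ X , c₂ X , Κ 0ℤ ⟩)
         ⟨ -ᵉ (c₀ X +ᵉ c₂ X) , c₀ X , Κ 0ℤ ⟩ ⟨ + x , + y , + z ⟩ 𝟘 𝟘 refl)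

W-+ : ∀ x y z x′ y′ z′ → W (x + x′) (y + y′) (z + z′) ≡ W x y z ⊞ W x′ y′ z′
W-+ x y z x′ y′ z′ = cong₂ _,_ (α−-+ y x y′ x′) (α−-+ z y z′ y′)

E₀ : ℤ[α]²
E₀ = W 1 1 1

W-nar : ∀ k → W (nar (3 + k)) (nar (2 + k)) (nar (1 + k)) ≡ M^ k E₀
W-nar zero = refl
W-nar (suc k) = begin
  W (nar (3 + k) + nar (1 + k)) (nar (3 + k)) (nar (2 + k))  ≡⟨ sym (M-W _ _ _) ⟩
  M (W (nar (3 + k)) (nar (2 + k)) (nar (1 + k)))          ≡⟨ cong M (W-nar k) ⟩
  M (M^ k E₀)                                              ≡⟨ sym (M^-suc k E₀) ⟩
  M^ (suc k) E₀                                            ∎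
  where open ≡-Reasoning

record Mixture (Y X₁ X₂ X₃ : ℤ[α]) : Set where
  field
    L : ℕ
    l₁ l₂ l₃ : ℤ[α]
    l₁≥0 : Nonneg l₁
    l₂≥0 : Nonneg l₂
    l₃≥0 : Nonneg l₃
    total : l₁ ⊕ l₂ ⊕ l₃ ≡ ι (suc L)
    mix : ι (suc L) ⊗ Y ≡ l₁ ⊗ X₁ ⊕ l₂ ⊗ X₂ ⊕ l₃ ⊗ X₃

Nonneg-affine-mixture : ∀ A B {Y X₁ X₂ X₃} → Mixture Y X₁ X₂ X₃ →
  Nonneg (A ⊗ X₁ ⊕ B) → Nonneg (A ⊗ X₂ ⊕ B) → Nonneg (A ⊗ X₃ ⊕ B) → Nonneg (A ⊗ Y ⊕ B)
Nonneg-affine-mixture A B {Y} {X₁} {X₂} {X₃} m n₁ n₂ n₃ =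
  Nonneg-cancel L
    (subst Nonneg eq (Nonneg-⊕ (Nonneg-⊕ (Nonneg-⊗ l₁≥0 n₁) (Nonneg-⊗ l₂≥0 n₂)) (Nonneg-⊗ l₃≥0 n₃)))
  where
  open Mixture m
  expand : ∀ l₁ l₂ l₃ X₁ X₂ X₃ A B →
    l₁ ⊗ (A ⊗ X₁ ⊕ B) ⊕ l₂ ⊗ (A ⊗ X₂ ⊕ B) ⊕ l₃ ⊗ (A ⊗ X₃ ⊕ B) ≡
    A ⊗ (l₁ ⊗ X₁ ⊕ l₂ ⊗ X₂ ⊕ l₃ ⊗ X₃) ⊕ (l₁ ⊕ l₂ ⊕ l₃) ⊗ B
  expand = ring-solve-∀ ℤ[α]-ring
  collect : ∀ l A Y B → A ⊗ (l ⊗ Y) ⊕ l ⊗ B ≡ l ⊗ (A ⊗ Y ⊕ B)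
  collect = ring-solve-∀ ℤ[α]-ring
  eq : l₁ ⊗ (A ⊗ X₁ ⊕ B) ⊕ l₂ ⊗ (A ⊗ X₂ ⊕ B) ⊕ l₃ ⊗ (A ⊗ X₃ ⊕ B) ≡ ι (suc L) ⊗ (A ⊗ Y ⊕ B)
  eq = begin
    l₁ ⊗ (A ⊗ X₁ ⊕ B) ⊕ l₂ ⊗ (A ⊗ X₂ ⊕ B) ⊕ l₃ ⊗ (A ⊗ X₃ ⊕ B)  ≡⟨ expand l₁ l₂ l₃ X₁ X₂ X₃ A B ⟩
    A ⊗ (l₁ ⊗ X₁ ⊕ l₂ ⊗ X₂ ⊕ l₃ ⊗ X₃) ⊕ (l₁ ⊕ l₂ ⊕ l₃) ⊗ B
      ≡⟨ cong₂ (λ u v → A ⊗ u ⊕ v ⊗ B) (sym mix) total ⟩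
    A ⊗ (ι (suc L) ⊗ Y) ⊕ ι (suc L) ⊗ B                          ≡⟨ collect (ι (suc L)) A Y B ⟩
    ι (suc L) ⊗ (A ⊗ Y ⊕ B)                                      ∎
    where open ≡-Reasoning

record InStrip (X : ℤ[α]) : Set where
  constructor _,_
  field
    below-top : Nonneg (⊖ 𝟙 ⊗ X ⊕ ι 20 ⊗ α)
    above-bottom : Nonneg (ι 10 ⊗ X ⊕ (ι 200 ⊗ α ⊕ ⊖ ι 20))

in-strip : ∀ {X} (k₁ k₂ : ℕ) {_ : True (natCoeffs? (α^ k₁ ⊗ (⊖ 𝟙 ⊗ X ⊕ ι 20 ⊗ α)))}
           {_ : True (natCoeffs? (α^ k₂ ⊗ (ι 10 ⊗ X ⊕ (ι 200 ⊗ α ⊕ ⊖ ι 20))))} → InStrip X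
in-strip k₁ k₂ {c₁} {c₂} = (k₁ , toWitness c₁) , (k₂ , toWitness c₂)

InStrip-mixture : ∀ {Y X₁ X₂ X₃} → Mixture Y X₁ X₂ X₃ → InStrip X₁ → InStrip X₂ → InStrip X₃ → InStrip Y
InStrip-mixture m (u₁ , l₁) (u₂ , l₂) (u₃ , l₃) =
    Nonneg-affine-mixture (⊖ 𝟙) (ι 20 ⊗ α) m u₁ u₂ u₃
  , Nonneg-affine-mixture (ι 10) (ι 200 ⊗ α ⊕ ⊖ ι 20) m l₁ l₂ l₃

data InHull {n} (v : Fin n → ℤ[α]²) (T : ℤ[α]²) : Set where
  is-vertex : ∀ j → v j ≡ T → InHull v T
  combination : ∀ (i₁ i₂ i₃ : Fin n) (L : ℕ) (w₁ w₂ w₃ : Σ ℤ[α] Nonneg) →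
    proj₁ w₁ ⊕ proj₁ w₂ ⊕ proj₁ w₃ ≡ ι (suc L) →
    ι (suc L) • T ≡ proj₁ w₁ • v i₁ ⊞ proj₁ w₂ • v i₂ ⊞ proj₁ w₃ • v i₃ → InHull v T

weight : (l : ℤ[α]) (k : ℕ) {_ : True (natCoeffs? (α^ k ⊗ l))} → Σ ℤ[α] Nonneg
weight l k {c} = l , k , toWitness c

-- By convexity this puts all of 20 y + M^K (conv v) in the strip. If M Q ⊆ Q and 20 E₀ + M³ Q ⊆ Q
-- for Q = conv v, then for y = w n it covers 20 · w (n + m) for every m that is a sum of Narayana
-- numbers nar (3 + k), k ≥ K, pairwise at least three indices apart.
Admissible : ∀ {n} → (Fin n → ℤ[α]²) → ℕ → ℤ[α]² → Set
Admissible v K y = ∀ i → InStrip (ι 20 ⊗ proj₁ y ⊕ proj₁ (M^ K (v i)))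

InStrip-hull : ∀ {n} {v : Fin n → ℤ[α]²} {T K y} → InHull v T → Admissible v K y →
               InStrip (ι 20 ⊗ proj₁ y ⊕ proj₁ (M^ K T))
InStrip-hull (is-vertex j refl) adm = adm j
InStrip-hull {v = v} {T} {K} {y} (combination i₁ i₂ i₃ L (l₁ , n₁) (l₂ , n₂) (l₃ , n₃) total mix) adm =
  InStrip-mixture {c ⊕ φ T} {c ⊕ φ (v i₁)} {c ⊕ φ (v i₂)} {c ⊕ φ (v i₃)}
    (record { L = L ; l₁ = l₁ ; l₂ = l₂ ; l₃ = l₃ ; l₁≥0 = n₁ ; l₂≥0 = n₂ ; l₃≥0 = n₃
            ; total = total ; mix = mix′ })
    (adm i₁) (adm i₂) (adm i₃)
  where
  c : ℤ[α]
  c = ι 20 ⊗ proj₁ y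
  φ : ℤ[α]² → ℤ[α]
  φ S = proj₁ (M^ K S)
  φ-⊞ : ∀ S S′ → φ (S ⊞ S′) ≡ φ S ⊕ φ S′
  φ-⊞ S S′ = cong proj₁ (M^-⊞ K S S′)
  φ-• : ∀ l S → φ (l • S) ≡ l ⊗ φ S
  φ-• l S = cong proj₁ (M^-• K l S)
  rearrange : ∀ l₁ l₂ l₃ c P₁ P₂ P₃ →
    (l₁ ⊕ l₂ ⊕ l₃) ⊗ c ⊕ (l₁ ⊗ P₁ ⊕ l₂ ⊗ P₂ ⊕ l₃ ⊗ P₃) ≡ l₁ ⊗ (c ⊕ P₁) ⊕ l₂ ⊗ (c ⊕ P₂) ⊕ l₃ ⊗ (c ⊕ P₃)
  rearrange = ring-solve-∀ ℤ[α]-ring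
  distrib : ∀ l c P → l ⊗ (c ⊕ P) ≡ l ⊗ c ⊕ l ⊗ P
  distrib = ring-solve-∀ ℤ[α]-ring
  mix′ : ι (suc L) ⊗ (c ⊕ φ T) ≡ l₁ ⊗ (c ⊕ φ (v i₁)) ⊕ l₂ ⊗ (c ⊕ φ (v i₂)) ⊕ l₃ ⊗ (c ⊕ φ (v i₃))
  mix′ = begin
    ι (suc L) ⊗ (c ⊕ φ T)                         ≡⟨ distrib (ι (suc L)) c (φ T) ⟩
    ι (suc L) ⊗ c ⊕ ι (suc L) ⊗ φ T
      ≡⟨ cong₂ _⊕_ (cong (_⊗ c) (sym total)) (sym (φ-• (ι (suc L)) T)) ⟩
    (l₁ ⊕ l₂ ⊕ l₃) ⊗ c ⊕ φ (ι (suc L) • T)        ≡⟨ cong (λ S → (l₁ ⊕ l₂ ⊕ l₃) ⊗ c ⊕ φ S) mix ⟩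
    (l₁ ⊕ l₂ ⊕ l₃) ⊗ c ⊕ φ (l₁ • v i₁ ⊞ l₂ • v i₂ ⊞ l₃ • v i₃)
      ≡⟨ cong ((l₁ ⊕ l₂ ⊕ l₃) ⊗ c ⊕_)
           (trans (φ-⊞ _ _) (cong₂ _⊕_ (trans (φ-⊞ _ _) (cong₂ _⊕_ (φ-• l₁ _) (φ-• l₂ _))) (φ-• l₃ _))) ⟩
    (l₁ ⊕ l₂ ⊕ l₃) ⊗ c ⊕ (l₁ ⊗ φ (v i₁) ⊕ l₂ ⊗ φ (v i₂) ⊕ l₃ ⊗ φ (v i₃))
      ≡⟨ rearrange l₁ l₂ l₃ c (φ (v i₁)) (φ (v i₂)) (φ (v i₃)) ⟩
    l₁ ⊗ (c ⊕ φ (v i₁)) ⊕ l₂ ⊗ (c ⊕ φ (v i₂)) ⊕ l₃ ⊗ (c ⊕ φ (v i₃)) ∎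
    where open ≡-Reasoning

module _ {n} {v : Fin n → ℤ[α]²} where

  Admissible-origin : (∀ i → InStrip (proj₁ (v i))) → Admissible v 0 (𝟘 , 𝟘)
  Admissible-origin in-strip i = subst InStrip (sym (⊕-identityˡ (proj₁ (v i)))) (in-strip i)

  Admissible-suc : (∀ i → InHull v (M (v i))) → ∀ {K y} → Admissible v K y → Admissible v (suc K) y
  Admissible-suc M-closed {K} {y} adm i = InStrip-hull {K = K} {y} (M-closed i) adm

  Admissible-shift : (∀ i → InHull v (ι 20 • E₀ ⊞ M (M (M (v i))))) →
                     ∀ {k y} → Admissible v k y → Admissible v (3 + k) (M^ k E₀ ⊞ y)
  Admissible-shift shift-closed {k} {y} adm i =
    subst InStrip eq (InStrip-hull {K = k} {y} (shift-closed i) adm)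
    where
    regroup : ∀ D A B C → D ⊗ B ⊕ (D ⊗ A ⊕ C) ≡ D ⊗ (A ⊕ B) ⊕ C
    regroup = ring-solve-∀ ℤ[α]-ring
    eq : ι 20 ⊗ proj₁ y ⊕ proj₁ (M^ k (ι 20 • E₀ ⊞ M (M (M (v i))))) ≡
         ι 20 ⊗ proj₁ (M^ k E₀ ⊞ y) ⊕ proj₁ (M^ (3 + k) (v i))
    eq = begin
      ι 20 ⊗ proj₁ y ⊕ proj₁ (M^ k (ι 20 • E₀ ⊞ M (M (M (v i)))))
        ≡⟨ cong (λ S → ι 20 ⊗ proj₁ y ⊕ proj₁ S)
             (trans (M^-⊞ k (ι 20 • E₀) (M (M (M (v i))))) (cong (_⊞ M^ (3 + k) (v i)) (M^-• k (ι 20) E₀))) ⟩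
      ι 20 ⊗ proj₁ y ⊕ (ι 20 ⊗ proj₁ (M^ k E₀) ⊕ proj₁ (M^ (3 + k) (v i)))
        ≡⟨ regroup (ι 20) (proj₁ (M^ k E₀)) (proj₁ y) (proj₁ (M^ (3 + k) (v i))) ⟩
      ι 20 ⊗ proj₁ (M^ k E₀ ⊞ y) ⊕ proj₁ (M^ (3 + k) (v i)) ∎
      where open ≡-Reasoning

  InStrip-origin : InHull v (𝟘 , 𝟘) → ∀ {K y} → Admissible v K y → InStrip (ι 20 ⊗ proj₁ y)
  InStrip-origin 𝟘∈v {K} {y} adm = subst InStrip eq (InStrip-hull {K = K} {y} 𝟘∈v adm)
    where
    eq : ι 20 ⊗ proj₁ y ⊕ proj₁ (M^ K (𝟘 , 𝟘)) ≡ ι 20 ⊗ proj₁ y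
    eq = trans (cong (λ S → ι 20 ⊗ proj₁ y ⊕ proj₁ S) (M^-𝟘 K))
               (trans (⊕-comm (ι 20 ⊗ proj₁ y) 𝟘) (⊕-identityˡ (ι 20 ⊗ proj₁ y)))

strip⇒upper : ∀ h n → Nonneg (⊖ 𝟙 ⊗ (ι 20 ⊗ (h α− n)) ⊕ ι 20 ⊗ α) → (h ∸ 1) ·α≤ n
strip⇒upper zero n _ = 0·α≤ n
strip⇒upper (suc h) n gap =
  Nonneg⇒·α≤ {h} {n} (Nonneg-cancel 19 {⟨ + n , ℤ.- + h , 0ℤ ⟩} (subst Nonneg eq gap))
  where
  eq : ⊖ 𝟙 ⊗ (ι 20 ⊗ (suc h α− n)) ⊕ ι 20 ⊗ α ≡ ι 20 ⊗ ⟨ + n , ℤ.- + h , 0ℤ ⟩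
  eq = prove (κ³ (⊖ 𝟙) ⊗ᵉ (κ³ (ι 20) ⊗ᵉ ⟨ -ᵉ c₀ X , Κ 1ℤ +ᵉ c₁ X , Κ 0ℤ ⟩) ⊕ᵉ κ³ (ι 20) ⊗ᵉ κ³ α)
             (κ³ (ι 20) ⊗ᵉ ⟨ c₀ X , -ᵉ c₁ X , Κ 0ℤ ⟩) ⟨ + n , + h , 0ℤ ⟩ 𝟘 𝟘 refl

strip⇒lower : ∀ h n → Nonneg (ι 10 ⊗ (ι 20 ⊗ (h α− n)) ⊕ (ι 200 ⊗ α ⊕ ⊖ ι 20)) → ¬ (suc h ·α≤ n)
strip⇒lower h n gap [1+h]α≤n =
  ·α≤⇒¬suc≤·α {10 * suc h} {10 * n} (·α≤-scale 10 {suc h} {n} [1+h]α≤n)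
    (Nonneg⇒≤·α {10 * suc h} {suc (10 * n)} (subst Nonneg eq′ (Nonneg-cancel 19 {t} (subst Nonneg eq gap))))
  where
  t : ℤ[α]
  t = ⟨ ℤ.- (1ℤ ℤ.+ + 10 ℤ.* + n) , + 10 ℤ.* (1ℤ ℤ.+ + h) , 0ℤ ⟩
  eq : ι 10 ⊗ (ι 20 ⊗ (h α− n)) ⊕ (ι 200 ⊗ α ⊕ ⊖ ι 20) ≡ ι 20 ⊗ t
  eq = prove (κ³ (ι 10) ⊗ᵉ (κ³ (ι 20) ⊗ᵉ ⟨ -ᵉ c₀ X , c₁ X , Κ 0ℤ ⟩) ⊕ᵉ (κ³ (ι 200) ⊗ᵉ κ³ α ⊕ᵉ ⊖ᵉ κ³ (ι 20)))
             (κ³ (ι 20) ⊗ᵉ ⟨ -ᵉ (Κ 1ℤ +ᵉ Κ (+ 10) *ᵉ c₀ X) , Κ (+ 10) *ᵉ (Κ 1ℤ +ᵉ c₁ X) , Κ 0ℤ ⟩)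
             ⟨ + n , + h , 0ℤ ⟩ 𝟘 𝟘 refl
  eq′ : t ≡ ⟨ ℤ.- + suc (10 * n) , + (10 * suc h) , 0ℤ ⟩
  eq′ = cong₂ (λ a b → ⟨ a , b , 0ℤ ⟩)
              (cong (λ i → ℤ.- (1ℤ ℤ.+ i)) (sym (ℤ.pos-* 10 n))) (sym (ℤ.pos-* 10 (suc h)))

module Polygon where
  open import Agda.Builtin.FromNat using (Number; fromNat)
  open import Agda.Builtin.FromNeg using (Negative)
  open import Data.Unit.Base using (tt)
  import Data.Nat.Literals as ℕ-Literals
  import Data.Integer.Literals as ℤ-Literals
  open import Data.Vec using ([]; _∷_)
  open import Data.Vec.Relation.Unary.All using ([]; _∷_)

  instance
    ℕ-number : Number ℕ
    ℕ-number = ℕ-Literals.number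
    ℤ-number : Number ℤ
    ℤ-number = ℤ-Literals.number
    ℤ-negative : Negative ℤ
    ℤ-negative = ℤ-Literals.negative

  vertices : Vec ℤ[α]² 11
  vertices =
      (⟨ -23 , 0 , 0 ⟩ , ⟨ -5 , 0 , 0 ⟩)
    ∷ (⟨ 37 , -15 , -11 ⟩ , ⟨ 26 , -15 , -11 ⟩)
    ∷ (⟨ -1 , 0 , 0 ⟩ , ⟨ -23 , 0 , 0 ⟩)
    ∷ (⟨ -23 , 18 , 5 ⟩ , ⟨ -23 , 0 , 0 ⟩)
    ∷ (⟨ 23 , 0 , 0 ⟩ , ⟨ -13 , 0 , 0 ⟩)
    ∷ (⟨ 43 , 5 , -11 ⟩ , ⟨ 17 , 5 , -11 ⟩)
    ∷ (⟨ 26 , 0 , 0 ⟩ , ⟨ 11 , 0 , 0 ⟩)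
    ∷ (⟨ 13 , 50 , -31 ⟩ , ⟨ 12 , 50 , -31 ⟩)
    ∷ (⟨ 1 , 0 , 0 ⟩ , ⟨ 31 , 0 , 0 ⟩)
    ∷ (⟨ 26 , -15 , -11 ⟩ , ⟨ 26 , 0 , 0 ⟩)
    ∷ (⟨ -6 , 80 , -62 ⟩ , ⟨ 13 , 50 , -31 ⟩)
    ∷ []

  vertex : Fin 11 → ℤ[α]²
  vertex = Vec.lookup vertices

  M-closed : ∀ i → InHull vertex (M (vertex i))
  M-closed = lookup⁺ {P = λ q → InHull vertex (M q)} {xs = vertices} (
      is-vertex (# 3) refl
    ∷ combination (# 0) (# 4) (# 5) 288110266
          (weight ⟨ -21322600 , 41391700 , 612900 ⟩ 2) (weight ⟨ -93819440 , 182123480 , 2696760 ⟩ 2)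
          (weight ⟨ 403252307 , -223515180 , -3309660 ⟩ 7) refl refl
    ∷ combination (# 0) (# 4) (# 5) 576220533
          (weight ⟨ 355628716 , 240991102 , -273843423 ⟩ 4) (weight ⟨ 66592962 , -207324326 , 120396167 ⟩ 8)
          (weight ⟨ 153998856 , -33666776 , 153447256 ⟩ 1) refl refl
    ∷ combination (# 0) (# 7) (# 8) 8746187
          (weight ⟨ 11616427 , -2270099 , -2952564 ⟩ 7) (weight ⟨ 2556696 , 878748 , 1142928 ⟩ 0)
          (weight ⟨ -5426935 , 1391351 , 1809636 ⟩ 6) refl refl
    ∷ combination (# 0) (# 7) (# 8) 795107
          (weight ⟨ 1297555 , 384526 , -795955 ⟩ 7) (weight ⟨ 267180 , -1072200 , 641544 ⟩ 8)
          (weight ⟨ -769627 , 687674 , 154411 ⟩ 2) refl refl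
    ∷ combination (# 0) (# 8) (# 9) 8485403
          (weight ⟨ -4211328 , -1228895 , 2920229 ⟩ 9) (weight ⟨ 2740140 , 866255 , -562469 ⟩ 3)
          (weight ⟨ 9956592 , 362640 , -2357760 ⟩ 4) refl refl
    ∷ is-vertex (# 9) refl
    ∷ is-vertex (# 10) refl
    ∷ combination (# 0) (# 8) (# 9) 8485403
          (weight ⟨ 6624075 , -1135275 , 899650 ⟩ 4) (weight ⟨ -1357755 , -7038705 , 5577830 ⟩ 8)
          (weight ⟨ 3219084 , 8173980 , -6477480 ⟩ 6) refl refl
    ∷ is-vertex (# 1) refl
    ∷ combination (# 0) (# 1) (# 2) 73945357
          (weight ⟨ 17736893 , -133537339 , 83205195 ⟩ 11) (weight ⟨ 2725260 , 149475060 , -94172882 ⟩ 6)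
          (weight ⟨ 53483205 , -15937721 , 10967687 ⟩ 4) refl refl
    ∷ [])

  shift-closed : ∀ i → InHull vertex (ι 20 • E₀ ⊞ M (M (M (vertex i))))
  shift-closed = lookup⁺ {P = λ q → InHull vertex (ι 20 • E₀ ⊞ M (M (M q)))} {xs = vertices} (
      combination (# 0) (# 7) (# 8) 728848
          (weight ⟨ 1231862 , -1328040 , 438991 ⟩ 7) (weight ⟨ -312271 , 514080 , -169932 ⟩ 6)
          (weight ⟨ -190742 , 813960 , -269059 ⟩ 3) refl refl
    ∷ combination (# 0) (# 7) (# 8) 8746187
          (weight ⟨ -1747461 , 34668141 , -20831530 ⟩ 6) (weight ⟨ 19579488 , -17651952 , 4960332 ⟩ 7)
          (weight ⟨ -9085839 , -17016189 , 15871198 ⟩ 12) refl refl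
    ∷ combination (# 0) (# 5) (# 6) 455806
          (weight ⟨ -393427 , 728477 , -207509 ⟩ 6) (weight ⟨ -1843273 , 2185431 , -622527 ⟩ 12)
          (weight ⟨ 2692507 , -2913908 , 830036 ⟩ 8) refl refl
    ∷ combination (# 0) (# 4) (# 5) 576220533
          (weight ⟨ 813584449 , -370674678 , -38258415 ⟩ 7) (weight ⟨ 756290959 , -593771622 , 119773241 ⟩ 7)
          (weight ⟨ -993654874 , 964446300 , -81514826 ⟩ 6) refl refl
    ∷ combination (# 0) (# 4) (# 5) 576220533
          (weight ⟨ 139615983 , 40254930 , -50438910 ⟩ 4) (weight ⟨ 441444165 , 177121692 , -221931204 ⟩ 4)
          (weight ⟨ -4839614 , -217376622 , 272370114 ⟩ 2) refl refl
    ∷ combination (# 0) (# 4) (# 5) 576220533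
          (weight ⟨ -285689977 , -51530775 , 178893731 ⟩ 8) (weight ⟨ -277460991 , 61374857 , 153289829 ⟩ 5)
          (weight ⟨ 1139371502 , -9844082 , -332183560 ⟩ 4) refl refl
    ∷ is-vertex (# 5) refl
    ∷ combination (# 0) (# 5) (# 6) 455806
          (weight ⟨ 1109227 , 351685 , -754016 ⟩ 13) (weight ⟨ 3244807 , 3126905 , -3546595 ⟩ 10)
          (weight ⟨ -3898227 , -3478590 , 4300611 ⟩ 8) refl refl
    ∷ is-vertex (# 7) refl
    ∷ combination (# 0) (# 7) (# 8) 8746187
          (weight ⟨ 2542944 , 23340741 , -17087195 ⟩ 13) (weight ⟨ 14815200 , -13267152 , 3510912 ⟩ 7)
          (weight ⟨ -8611956 , -10073589 , 13576283 ⟩ 5) refl refl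
    ∷ combination (# 0) (# 7) (# 8) 4373093
          (weight ⟨ -20148137 , -3923660 , 12189231 ⟩ 12) (weight ⟨ 11184900 , 12804240 , -13464600 ⟩ 7)
          (weight ⟨ 13336331 , -8880580 , 1275369 ⟩ 7) refl refl
    ∷ [])

  origin-in-hull : InHull vertex (𝟘 , 𝟘)
  origin-in-hull = combination (# 0) (# 5) (# 6) 455806
    (weight ⟨ 181519 , 54489 , -8364 ⟩ 3) (weight ⟨ -76998 , 163467 , -25092 ⟩ 3)
    (weight ⟨ 351286 , -217956 , 33456 ⟩ 4) refl refl

  vertices-in-strip : ∀ i → InStrip (proj₁ (vertex i))
  vertices-in-strip = lookup⁺ {P = λ q → InStrip (proj₁ q)} {xs = vertices} (
      in-strip 0 6
    ∷ in-strip 2 4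
    ∷ in-strip 0 2
    ∷ in-strip 4 2
    ∷ in-strip 6 0
    ∷ in-strip 9 3
    ∷ in-strip 6 0
    ∷ in-strip 5 3
    ∷ in-strip 2 2
    ∷ in-strip 2 4
    ∷ in-strip 1 6
    ∷ [])

module Hofstadter (H : ℕ → ℕ) (H-zero : H 0 ≡ 0) (H-suc : ∀ n → H (suc n) ≡ suc n ∸ H (H (H n))) where
  open Polygon

  H-suc-from-H³ : ∀ n {v} → H (H (H n)) ≡ v → H (suc n) ≡ suc n ∸ v
  H-suc-from-H³ n e = trans (H-suc n) (cong (suc n ∸_) e)

  H³≡ : ∀ {n a b c} → H n ≡ a → H a ≡ b → H b ≡ c → H (H (H n)) ≡ c
  H³≡ e₁ e₂ e₃ = trans (cong (H ∘ H) e₁) (trans (cong H e₂) e₃)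

  H²-zero : H (H 0) ≡ 0
  H²-zero = trans (cong H H-zero) H-zero

  H-1 : H 1 ≡ 1
  H-1 = H-suc-from-H³ 0 (H³≡ H-zero H-zero H-zero)

  H-2 : H 2 ≡ 1
  H-2 = H-suc-from-H³ 1 (H³≡ H-1 H-1 H-1)

  H-3 : H 3 ≡ 2
  H-3 = H-suc-from-H³ 2 (H³≡ H-2 H-1 H-1)

  H-4 : H 4 ≡ 3
  H-4 = H-suc-from-H³ 3 (H³≡ H-3 H-2 H-1)

  -- H(n + 2) = n + 2 − H³(n + 1) moves opposite to H³.
  H-step-from-H³ : ∀ n → H (H (H n)) ≤ suc n → StepAt (H ∘ H ∘ H) n → StepAt H (suc n)
  H-step-from-H³ n H³n≤ (inj₁ e) = inj₂ (begin
    H (suc (suc n))                  ≡⟨ H-suc-from-H³ (suc n) e ⟩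
    suc (suc n) ∸ H (H (H n))        ≡⟨ ℕ.+-∸-assoc 1 H³n≤ ⟩
    suc (suc n ∸ H (H (H n)))        ≡⟨ cong suc (sym (H-suc n)) ⟩
    suc (H (suc n))                  ∎)
    where open ≡-Reasoning
  H-step-from-H³ n _ (inj₂ e) = inj₁ (trans (H-suc-from-H³ (suc n) e) (sym (H-suc n)))

  H-step : ∀ n → StepAt H n
  H-step = <-rec (StepAt H) step
    where
    step : ∀ n → (∀ {m} → m < n → StepAt H m) → StepAt H n
    step zero _ = inj₂ (trans H-1 (cong suc (sym H-zero)))
    step (suc n) rec = H-step-from-H³ n (ℕ.m≤n⇒m≤1+n H³n≤n)
      (StepAt-∘ {H ∘ H} {H} (StepAt-∘ {H} {H} (rec (ℕ.n<1+n n)) (rec (s≤s Hn≤n))) (rec (s≤s H²n≤n)))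
      where
      H≤ : ∀ m → m ≤ n → H m ≤ m
      H≤ m m≤n = steps⇒≤ H-zero m (λ k<m → rec (ℕ.≤-trans k<m (ℕ.m≤n⇒m≤1+n m≤n)))
      Hn≤n : H n ≤ n
      Hn≤n = H≤ n ℕ.≤-refl
      H²n≤n : H (H n) ≤ n
      H²n≤n = ℕ.≤-trans (H≤ (H n) Hn≤n) Hn≤n
      H³n≤n : H (H (H n)) ≤ n
      H³n≤n = ℕ.≤-trans (H≤ (H (H n)) H²n≤n) H²n≤n

  H-≤ : ∀ n → H n ≤ n
  H-≤ n = steps⇒≤ H-zero n (λ {m} _ → H-step m)

  H-mono : ∀ {m n} → m ≤ n → H m ≤ H n
  H-mono = steps⇒mono H-step

  H-shift-suc : ∀ t s → H (H (H (nar (6 + t) + s))) ≡ nar (3 + t) + H (H (H s)) →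
                H (nar (6 + t) + suc s) ≡ nar (5 + t) + H (suc s)
  H-shift-suc t s H³n = begin
    H (nar (6 + t) + suc s)               ≡⟨ cong H (ℕ.+-suc (nar (6 + t)) s) ⟩
    H (suc n)                             ≡⟨ H-suc-from-H³ n H³n ⟩
    suc n ∸ (nar (3 + t) + H (H (H s)))   ≡⟨ ∸-absorbˡ (nar (5 + t)) (nar (3 + t)) s _ H³s≤s ⟩
    nar (5 + t) + (suc s ∸ H (H (H s)))   ≡⟨ cong (nar (5 + t) ℕ.+_) (sym (H-suc s)) ⟩
    nar (5 + t) + H (suc s)               ∎
    where
    open ≡-Reasoning
    n : ℕ
    n = nar (6 + t) + s
    H³s≤s : H (H (H s)) ≤ s
    H³s≤s = ℕ.≤-trans (H-≤ _) (ℕ.≤-trans (H-≤ _) (H-≤ s))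

  -- H shifts the greedy Narayana expansion of its argument: nar (4 + t) + r ↦ nar (3 + t) + H r.
  H-nar : ∀ k → H (nar (3 + k)) ≡ nar (2 + k)
  H-shift : ∀ t r → r ≤ nar (2 + t) → H (nar (4 + t) + r) ≡ nar (3 + t) + H r

  H-nar zero = H-1
  H-nar (suc k) = begin
    H (nar (4 + k))      ≡⟨ cong H (sym (ℕ.+-identityʳ _)) ⟩
    H (nar (4 + k) + 0)  ≡⟨ H-shift k 0 z≤n ⟩
    nar (3 + k) + H 0    ≡⟨ cong (nar (3 + k) ℕ.+_) H-zero ⟩
    nar (3 + k) + 0      ≡⟨ ℕ.+-identityʳ _ ⟩
    nar (3 + k)          ∎
    where open ≡-Reasoning

  H-shift 0 0 _ = trans H-2 (cong suc (sym H-zero))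
  H-shift 0 1 _ = trans H-3 (cong suc (sym H-1))
  H-shift 1 0 _ = trans H-3 (cong (2 ℕ.+_) (sym H-zero))
  H-shift 1 1 _ = trans H-4 (cong (2 ℕ.+_) (sym H-1))
  H-shift 0 (suc (suc r)) (s≤s ())
  H-shift 1 (suc (suc r)) (s≤s ())
  H-shift (suc (suc t)) zero _ = begin
    H (nar (6 + t) + 0)                ≡⟨ cong H (ℕ.+-identityʳ _) ⟩
    H (nar (5 + t) + nar (3 + t))      ≡⟨ H-shift (suc t) (nar (3 + t)) ℕ.≤-refl ⟩
    nar (4 + t) + H (nar (3 + t))      ≡⟨ cong (nar (4 + t) ℕ.+_) (H-nar t) ⟩
    nar (5 + t)                        ≡⟨ sym (trans (cong (nar (5 + t) ℕ.+_) H-zero) (ℕ.+-identityʳ _)) ⟩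
    nar (5 + t) + H 0                  ∎
    where open ≡-Reasoning
  H-shift (suc (suc t)) (suc s) s<nar =
    let s≤ : s ≤ nar (4 + t)
        s≤ = ℕ.≤-trans (ℕ.n≤1+n s) s<nar
        Hs≤ : H s ≤ nar (3 + t)
        Hs≤ = ℕ.≤-trans (H-mono s≤) (ℕ.≤-reflexive (H-nar (suc t)))
        H²s≤ : H (H s) ≤ nar (2 + t)
        H²s≤ = ℕ.≤-trans (H-mono Hs≤) (ℕ.≤-reflexive (H-nar t))
    in  H-shift-suc t s (begin
      H (H (H (nar (6 + t) + s)))  ≡⟨ cong (H ∘ H) (H-shift (suc (suc t)) s s≤) ⟩
      H (H (nar (5 + t) + H s))    ≡⟨ cong H (H-shift (suc t) (H s) Hs≤) ⟩
      H (nar (4 + t) + H (H s))    ≡⟨ H-shift t (H (H s)) H²s≤ ⟩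
      nar (3 + t) + H (H (H s))    ∎)
    where open ≡-Reasoning

  H-split : ∀ k r → r < nar (1 + k) → H (nar (3 + k) + r) ≡ nar (2 + k) + H r
  H-split zero zero _ = trans H-1 (cong suc (sym H-zero))
  H-split zero (suc r) (s≤s ())
  H-split (suc k) r r< = H-shift k r (ℕ.<⇒≤ r<)

  H²-split : ∀ k r → r < nar (1 + k) → H (H (nar (3 + k) + r)) ≡ nar (1 + k) + H (H r)
  H²-split 0 0 _ = trans (cong H H-1) (trans H-1 (cong suc (sym H²-zero)))
  H²-split 1 0 _ = trans (cong H H-2) (trans H-1 (cong suc (sym H²-zero)))
  H²-split 0 (suc r) (s≤s ())
  H²-split 1 (suc r) (s≤s ())
  H²-split (suc (suc k)) r r< = trans (cong H (H-split (2 + k) r r<)) (H-shift k (H r) Hr≤)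
    where
    Hr≤ : H r ≤ nar (2 + k)
    Hr≤ = ℕ.≤-trans (H-mono (ℕ.<⇒≤ r<)) (ℕ.≤-reflexive (H-nar k))

  w : ℕ → ℤ[α]²
  w n = W n (H n) (H (H n))

  w-split : ∀ k r → r < nar (1 + k) → w (nar (3 + k) + r) ≡ M^ k E₀ ⊞ w r
  w-split k r r< = begin
    W (nar (3 + k) + r) (H (nar (3 + k) + r)) (H (H (nar (3 + k) + r)))
      ≡⟨ cong₂ (W (nar (3 + k) + r)) (H-split k r r<) (H²-split k r r<) ⟩
    W (nar (3 + k) + r) (nar (2 + k) + H r) (nar (1 + k) + H (H r))
      ≡⟨ W-+ (nar (3 + k)) (nar (2 + k)) (nar (1 + k)) r (H r) (H (H r)) ⟩
    W (nar (3 + k)) (nar (2 + k)) (nar (1 + k)) ⊞ w r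
      ≡⟨ cong (_⊞ w r) (W-nar k) ⟩
    M^ k E₀ ⊞ w r ∎
    where open ≡-Reasoning

  admissible-w-shift : ∀ K {n} → n < nar (4 + K) → nar (3 + K) ≤ n →
                       Admissible vertex K (w (n ∸ nar (3 + K))) → Admissible vertex (3 + K) (w n)
  admissible-w-shift K {n} n< a≤n adm =
    subst (Admissible vertex (3 + K) ∘ w) (ℕ.m+[n∸m]≡n a≤n)
      (subst (Admissible vertex (3 + K)) (sym (w-split K (n ∸ nar (3 + K)) (nar-split K n< a≤n)))
        (Admissible-shift shift-closed {K} {w (n ∸ nar (3 + K))} adm))

  admissible-w : ∀ K n → n < nar (suc K) → Admissible vertex K (w n)
  admissible-w zero zero _ =
    subst (Admissible vertex 0) (sym (cong₂ (W 0) H-zero H²-zero))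
      (Admissible-origin {v = vertex} vertices-in-strip)
  admissible-w zero (suc n) (s≤s ())
  admissible-w 1 n n< = Admissible-suc M-closed {0} {w n} (admissible-w 0 n n<)
  admissible-w 2 n n< = Admissible-suc M-closed {1} {w n} (admissible-w 1 n n<)
  admissible-w (suc (suc (suc K))) n n< =
    [ (λ a≤n → admissible-w-shift K n< a≤n (admissible-w K (n ∸ nar (3 + K)) (nar-split K n< a≤n)))
    , (λ n<′ → Admissible-suc M-closed {2 + K} {w n} (admissible-w (suc (suc K)) n n<′))
    ]′ (ℕ.≤-<-connex (nar (3 + K)) n)

  scaled-discrepancy-in-strip : ∀ n → InStrip (ι 20 ⊗ (H n α− n))
  scaled-discrepancy-in-strip n = InStrip-origin origin-in-hull {2 + n} {w n} (admissible-w (2 + n) n (n<nar[3+n] n))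

theorem34 : (H : ℕ → ℕ) → H zero ≡ 0
    → (∀ i → H (suc i) ≡ suc i ∸ H (H (H i)))
    → ∀ i m → IsFloorDivα i m → (H i ≡ m ⊎ H i ≡ suc m)
theorem34 H H-zero H-suc i m floor =
  floor-pinned {H i} {m} {i} (strip⇒upper (H i) i below-top) (strip⇒lower (H i) i above-bottom) floor
  where
  open Hofstadter H H-zero H-suc
  open InStrip (scaled-discrepancy-in-strip i)
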